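{- Let $r,s$ be positive integers and for $n\in\mathbb{N}$ let $a_n(r,s)=\sum_{k\ge0}\binom{n}{k}^r\binom{n+k}{k}^s$. Then $$a_n(r,s)\equiv\begin{cases}(-1)^{\delta_3(n)}\pmod 3&\text{if } s \text{ is even},\\ 1\pmod 3&\text{if } s\text{ is odd and } n\in T(02),\\ 0\pmod 3&\text{otherwise.}\end{cases}$$
   Context: $\delta_3(n)$ denotes the number of digits equal to $1$ in the base-$3$ expansion of $n$. $T(02)$ denotes the set of $n\in\mathbb{N}$ whose base-$3$ expansion contains only the digits $0$ and $2$. -}

module Defs where

open import Data.Nat using (ℕ; zero; suc; _+_; _*_; _^_; _/_; _%_)
open import Data.Nat.Combinatorics using (_C_)
open import Data.List using (List; []; _∷_; upTo; map)
open import Data.Nat.ListAction using (sum)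
open import Data.List.Relation.Unary.All using (All)
open import Data.Sum using (_⊎_)
open import Relation.Binary.PropositionalEquality using (_≡_)
open import Data.Integer as ℤ using (ℤ; +_; _-_)
import Data.Integer.Divisibility as ℤD

-- base-3 digits of n, least significant first; fuel f ≥ n suffices
digits3-fuel : ℕ → ℕ → List ℕ
digits3-fuel zero    n       = []
digits3-fuel (suc f) zero    = []
digits3-fuel (suc f) (suc m) = ((suc m) % 3) ∷ digits3-fuel f ((suc m) / 3)

digits3 : ℕ → List ℕ
digits3 n = digits3-fuel n n

count1 : List ℕ → ℕ
count1 []             = 0
count1 (1 ∷ ds)       = suc (count1 ds)
count1 (_ ∷ ds)       = count1 ds

δ₃ : ℕ → ℕ
δ₃ n = count1 (digits3 n)

T02 : ℕ → Set
T02 n = All (λ d → d ≡ 0 ⊎ d ≡ 2) (digits3 n)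

-- a_n(r,s) = Σ_{k≥0} C(n,k)^r C(n+k,k)^s  (terms with k > n vanish)
a : ℕ → ℕ → ℕ → ℕ
a r s n = sum (map (λ k → ((n C k) ^ r) * (((n + k) C k) ^ s)) (upTo (suc n)))

infix 4 _≡_[mod_]
_≡_[mod_] : ℤ → ℤ → ℕ → Set
x ≡ y [mod m ] = (+ m) ℤD.∣ (x - y)

-1ℤ : ℤ
-1ℤ = ℤ.- (+ 1)

-- Modulo 3, a_n(r,s) is multiplicative in the base-3 digits of n:
-- a_{d + 3m} ≡ a_d a_m for every digit d.  Writing n = d + 3m, k = e + 3j
-- and applying Lucas' theorem to both binomials, the term of index (n, k)
-- is congruent to the product of the terms of indices (d, e) and (m, j),
-- except when the digit sum d + e carries; then 3 divides both C(n+k, k)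
-- and C(d+e, e), so both sides vanish (this uses s ≥ 1; r ≥ 1 makes the
-- terms with k > n vanish, so the sums may be cut into blocks of three).
-- Since a_0 = 1, a_2 ≡ 1 and a_1 = 1 + 2^s, a_n ≡ (1 + 2^s)^δ₃(n), where
-- 1 + 2^s ≡ -1 or 0 according to the parity of s.
module Submission where

open import Defs

module Mod3 where

  open import Data.Nat
  open import Data.Nat.Properties
  open import Data.Nat.DivMod
  open import Data.Nat.Combinatorics
  open import Data.Nat.ListAction using (sum; product)
  open import Data.Nat.Tactic.RingSolver using (solve-∀)
  open import Data.List using ([]; _∷_; map; applyUpTo)
  open import Data.List.Relation.Unary.All using (All; []; _∷_)
  open import Data.Sum using (_⊎_; inj₁; inj₂)
  open import Function using (_∘_)
  open import Level using (0ℓ)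
  open import Relation.Binary using (IsEquivalence; Setoid)
  open import Relation.Binary.PropositionalEquality
  open import Relation.Nullary using (¬_; yes; no; contradiction)

  infix 4 _≈₃_
  record _≈₃_ (x y : ℕ) : Set where
    constructor mk≈₃
    field %3-≡ : x % 3 ≡ y % 3

  ≡⇒≈₃ : ∀ {x y} → x ≡ y → x ≈₃ y
  ≡⇒≈₃ x≡y = mk≈₃ (cong (_% 3) x≡y)

  ≈₃-isEquivalence : IsEquivalence _≈₃_
  ≈₃-isEquivalence = record
    { refl  = mk≈₃ refl
    ; sym   = λ (mk≈₃ p) → mk≈₃ (sym p)
    ; trans = λ (mk≈₃ p) (mk≈₃ q) → mk≈₃ (trans p q)
    }

  ≈₃-setoid : Setoid 0ℓ 0ℓ
  ≈₃-setoid = record { isEquivalence = ≈₃-isEquivalence }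

  open IsEquivalence ≈₃-isEquivalence public
    using () renaming (refl to ≈₃-refl; sym to ≈₃-sym; trans to ≈₃-trans)
  import Relation.Binary.Reasoning.Setoid as SetoidReasoning
  module ≈₃-Reasoning = SetoidReasoning ≈₃-setoid

  +-cong₃ : ∀ {x y u v} → x ≈₃ y → u ≈₃ v → x + u ≈₃ y + v
  +-cong₃ {x} {y} {u} {v} (mk≈₃ p) (mk≈₃ q) = mk≈₃
    (trans (%-distribˡ-+ x u 3) (trans (cong₂ (λ a b → (a + b) % 3) p q) (sym (%-distribˡ-+ y v 3))))

  *-cong₃ : ∀ {x y u v} → x ≈₃ y → u ≈₃ v → x * u ≈₃ y * v
  *-cong₃ {x} {y} {u} {v} (mk≈₃ p) (mk≈₃ q) = mk≈₃
    (trans (%-distribˡ-* x u 3) (trans (cong₂ (λ a b → (a * b) % 3) p q) (sym (%-distribˡ-* y v 3))))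

  ^-congˡ₃ : ∀ {x y} n → x ≈₃ y → x ^ n ≈₃ y ^ n
  ^-congˡ₃ zero    _   = ≈₃-refl
  ^-congˡ₃ (suc n) x≈y = *-cong₃ x≈y (^-congˡ₃ n x≈y)

  *-zeroˡ₃ : ∀ {x} y → x ≈₃ 0 → x * y ≈₃ 0
  *-zeroˡ₃ y x≈0 = *-cong₃ x≈0 (≈₃-refl {y})

  *-zeroʳ₃ : ∀ x {y} → y ≈₃ 0 → x * y ≈₃ 0
  *-zeroʳ₃ x y≈0 = ≈₃-trans (*-cong₃ (≈₃-refl {x}) y≈0) (≡⇒≈₃ (*-zeroʳ x))

  ≈₃0⇒^suc≈₃0 : ∀ {x} n → x ≈₃ 0 → x ^ suc n ≈₃ 0
  ≈₃0⇒^suc≈₃0 n x≈0 = *-zeroˡ₃ _ x≈0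

  ^-distribʳ-* : ∀ x y n → (x * y) ^ n ≡ x ^ n * y ^ n
  ^-distribʳ-* x y zero    = refl
  ^-distribʳ-* x y (suc n) = trans (cong (x * y *_) (^-distribʳ-* x y n)) (interchange x y (x ^ n) (y ^ n))
    where
    interchange : ∀ a b c d → a * b * (c * d) ≡ a * c * (b * d)
    interchange = solve-∀

  2^n≈₃2^[n%2] : ∀ n → 2 ^ n ≈₃ 2 ^ (n % 2)
  2^n≈₃2^[n%2] zero          = ≈₃-refl
  2^n≈₃2^[n%2] (suc zero)    = ≈₃-refl
  2^n≈₃2^[n%2] (suc (suc n)) = ≈₃-trans 4x≈₃x (2^n≈₃2^[n%2] n)
    where
    4x≡x+x*3 : ∀ x → 2 * (2 * x) ≡ x + x * 3
    4x≡x+x*3 = solve-∀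
    4x≈₃x : 2 * (2 * 2 ^ n) ≈₃ 2 ^ n
    4x≈₃x = mk≈₃ (trans (cong (_% 3) (4x≡x+x*3 (2 ^ n))) ([m+kn]%n≡m%n (2 ^ n) (2 ^ n) 3))

  -- Lucas' theorem for p = 3 is proved row by row with Pascal's rule:
  -- LucasRow n m d says that n C k behaves as if n had last digit d and prefix m.
  LucasRow : ℕ → ℕ → ℕ → Set
  LucasRow n m d = ∀ j e → e < 3 → n C (e + j * 3) ≈₃ (m C j) * (d C e)

  lucasRow-zero : LucasRow 0 0 0
  lucasRow-zero zero    zero    _ = ≈₃-refl
  lucasRow-zero zero    (suc e) _ = ≈₃-refl
  lucasRow-zero (suc j) e       _ = ≡⇒≈₃ (k>n⇒nCk≡0 (≤-trans (s≤s z≤n) (m≤n+m (suc j * 3) e)))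

  module _ {n m d : ℕ} (row : LucasRow n m d) where
    open ≈₃-Reasoning

    lucasRow-pascal : ∀ j {e} → e < 2 → suc n C suc (e + j * 3) ≈₃ (m C j) * (suc d C suc e)
    lucasRow-pascal j {e} e<2 = begin
      suc n C suc (e + j * 3)                     ≡⟨ nCk+nC[k+1]≡[n+1]C[k+1] n (e + j * 3) ⟨
      n C (e + j * 3) + n C (suc e + j * 3)       ≈⟨ +-cong₃ (row j e (m<n⇒m<1+n e<2)) (row j (suc e) (s≤s e<2)) ⟩
      (m C j) * (d C e) + (m C j) * (d C suc e)   ≡⟨ *-distribˡ-+ (m C j) (d C e) (d C suc e) ⟨
      (m C j) * (d C e + d C suc e)               ≡⟨ cong ((m C j) *_) (nCk+nC[k+1]≡[n+1]C[k+1] d e) ⟩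
      (m C j) * (suc d C suc e)                   ∎

    lucasRow-nextBlock : ∀ j → suc n C (suc j * 3) ≈₃ (m C j) * (d C 2) + m C suc j
    lucasRow-nextBlock j = begin
      suc n C suc (2 + j * 3)               ≡⟨ nCk+nC[k+1]≡[n+1]C[k+1] n (2 + j * 3) ⟨
      n C (2 + j * 3) + n C (suc j * 3)     ≈⟨ +-cong₃ (row j 2 (n<1+n 2)) (row (suc j) 0 z<s) ⟩
      (m C j) * (d C 2) + (m C suc j) * 1   ≡⟨ cong (_+_ ((m C j) * (d C 2))) (*-identityʳ (m C suc j)) ⟩
      (m C j) * (d C 2) + m C suc j         ∎

    lucasRow-suc : d < 2 → LucasRow (suc n) m (suc d)
    lucasRow-suc _   zero    zero    _         = ≈₃-refl
    lucasRow-suc d<2 (suc j) zero    _         = begin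
      suc n C (suc j * 3)             ≈⟨ lucasRow-nextBlock j ⟩
      (m C j) * (d C 2) + m C suc j   ≡⟨ cong (λ c → (m C j) * c + m C suc j) (k>n⇒nCk≡0 d<2) ⟩
      (m C j) * 0 + m C suc j         ≡⟨ cong (_+ m C suc j) (*-zeroʳ (m C j)) ⟩
      m C suc j                       ≡⟨ *-identityʳ (m C suc j) ⟨
      (m C suc j) * 1                 ∎
    lucasRow-suc _   j       (suc e) (s≤s e<2) = lucasRow-pascal j e<2

  module _ {n m : ℕ} (row : LucasRow n m 2) where
    open ≈₃-Reasoning

    lucasRow-carry : LucasRow (suc n) (suc m) 0
    lucasRow-carry zero    zero    _         = ≈₃-refl
    lucasRow-carry (suc j) zero    _         = begin
      suc n C (suc j * 3)            ≈⟨ lucasRow-nextBlock row j ⟩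
      (m C j) * 1 + m C suc j        ≡⟨ cong (_+ m C suc j) (*-identityʳ (m C j)) ⟩
      m C j + m C suc j              ≡⟨ nCk+nC[k+1]≡[n+1]C[k+1] m j ⟩
      suc m C suc j                  ≡⟨ *-identityʳ (suc m C suc j) ⟨
      (suc m C suc j) * 1            ∎
    lucasRow-carry j       (suc e) (s≤s e<2) = begin
      suc n C suc (e + j * 3)        ≈⟨ lucasRow-pascal row j e<2 ⟩
      (m C j) * (3 C suc e)          ≈⟨ *-zeroʳ₃ (m C j) (3C[1+e]≈₃0 e<2) ⟩
      0                              ≡⟨ *-zeroʳ (suc m C j) ⟨
      (suc m C j) * 0                ∎
      where
      3C[1+e]≈₃0 : ∀ {e} → e < 2 → 3 C suc e ≈₃ 0
      3C[1+e]≈₃0 z<s       = mk≈₃ refl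
      3C[1+e]≈₃0 (s<s z<s) = mk≈₃ refl

  lucas : ∀ m d → d < 3 → LucasRow (d + m * 3) m d
  lucas zero    0 _ = lucasRow-zero
  lucas (suc m) 0 _ = lucasRow-carry (lucas m 2 (n<1+n 2))
  lucas m       1 _ = lucasRow-suc (lucas m 0 z<s) z<s
  lucas m       2 _ = lucasRow-suc (lucas m 1 (s<s z<s)) (s<s z<s)
  lucas m (suc (suc (suc _))) (s<s (s<s (s<s ())))

  ∑< : ℕ → (ℕ → ℕ) → ℕ
  ∑< zero    h = 0
  ∑< (suc N) h = h 0 + ∑< N (h ∘ suc)

  sum-map-applyUpTo : ∀ N (f h : ℕ → ℕ) → sum (map h (applyUpTo f N)) ≡ ∑< N (h ∘ f)
  sum-map-applyUpTo zero    f h = refl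
  sum-map-applyUpTo (suc N) f h = cong (h (f 0) +_) (sum-map-applyUpTo N (f ∘ suc) h)

  ∑<-zeros : ∀ N h → (∀ k → h k ≡ 0) → ∑< N h ≡ 0
  ∑<-zeros zero    h h≡0 = refl
  ∑<-zeros (suc N) h h≡0 = cong₂ _+_ (h≡0 0) (∑<-zeros N (h ∘ suc) (h≡0 ∘ suc))

  ∑<-extend : ∀ {N M} h → N ≤ M → (∀ k → N ≤ k → h k ≡ 0) → ∑< M h ≡ ∑< N h
  ∑<-extend {M = M} h z≤n       h≡0 = ∑<-zeros M h (λ k → h≡0 k z≤n)
  ∑<-extend         h (s≤s N≤M) h≡0 = cong (h 0 +_) (∑<-extend (h ∘ suc) N≤M (λ k → h≡0 (suc k) ∘ s≤s))

  ∑<-+ : ∀ A B h → ∑< (A + B) h ≡ ∑< A h + ∑< B (λ k → h (A + k))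
  ∑<-+ zero    B h = refl
  ∑<-+ (suc A) B h = trans (cong (h 0 +_) (∑<-+ A B (h ∘ suc))) (sym (+-assoc (h 0) _ _))

  ∑<-blocks : ∀ M h → ∑< (M * 3) h ≡ ∑< M (λ j → ∑< 3 (λ e → h (e + j * 3)))
  ∑<-blocks zero    h = refl
  ∑<-blocks (suc M) h = trans (∑<-+ 3 (M * 3) h) (cong (∑< 3 h +_) (∑<-blocks M (λ k → h (3 + k))))

  ∑<-cong₃ : ∀ N {h h′} → (∀ k → k < N → h k ≈₃ h′ k) → ∑< N h ≈₃ ∑< N h′
  ∑<-cong₃ zero    h≈h′ = ≈₃-refl
  ∑<-cong₃ (suc N) h≈h′ = +-cong₃ (h≈h′ 0 z<s) (∑<-cong₃ N (λ k → h≈h′ (suc k) ∘ s<s))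

  ∑<-*-distribˡ : ∀ N x h → ∑< N (λ k → x * h k) ≡ x * ∑< N h
  ∑<-*-distribˡ zero    x h = sym (*-zeroʳ x)
  ∑<-*-distribˡ (suc N) x h = trans (cong (x * h 0 +_) (∑<-*-distribˡ N x (h ∘ suc)))
                                    (sym (*-distribˡ-+ x (h 0) (∑< N (h ∘ suc))))

  ∑<-*-distribʳ : ∀ N h x → ∑< N (λ k → h k * x) ≡ ∑< N h * x
  ∑<-*-distribʳ zero    h x = refl
  ∑<-*-distribʳ (suc N) h x = trans (cong (h 0 * x +_) (∑<-*-distribʳ N (h ∘ suc) x))
                                    (sym (*-distribʳ-+ x (h 0) (∑< N (h ∘ suc))))

  digitwise-+ : ∀ d e m j → d + m * 3 + (e + j * 3) ≡ d + e + (m + j) * 3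
  digitwise-+ = solve-∀

  module _ {g : ℕ → ℕ} {x : ℕ} (g0 : g 0 ≈₃ 1) (g1 : g 1 ≈₃ x) (g2 : g 2 ≈₃ 1) where

    product-map-count1 : ∀ ds → All (_< 3) ds → product (map g ds) ≈₃ x ^ count1 ds
    product-map-count1 []       []         = ≈₃-refl
    product-map-count1 (0 ∷ ds) (_ ∷ ds<3) =
      ≈₃-trans (*-cong₃ g0 (product-map-count1 ds ds<3)) (≡⇒≈₃ (*-identityˡ _))
    product-map-count1 (1 ∷ ds) (_ ∷ ds<3) = *-cong₃ g1 (product-map-count1 ds ds<3)
    product-map-count1 (2 ∷ ds) (_ ∷ ds<3) =
      ≈₃-trans (*-cong₃ g2 (product-map-count1 ds ds<3)) (≡⇒≈₃ (*-identityˡ _))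
    product-map-count1 (suc (suc (suc _)) ∷ _) (s<s (s<s (s<s ())) ∷ _)

  digits3-fuel-<3 : ∀ f n → All (_< 3) (digits3-fuel f n)
  digits3-fuel-<3 zero    n       = []
  digits3-fuel-<3 (suc f) zero    = []
  digits3-fuel-<3 (suc f) (suc n) = m%n<n (suc n) 3 ∷ digits3-fuel-<3 f (suc n / 3)

  All02⇒count1≡0 : ∀ {ds} → All (λ d → d ≡ 0 ⊎ d ≡ 2) ds → count1 ds ≡ 0
  All02⇒count1≡0 []               = refl
  All02⇒count1≡0 (inj₁ refl ∷ ps) = All02⇒count1≡0 ps
  All02⇒count1≡0 (inj₂ refl ∷ ps) = All02⇒count1≡0 ps

  count1≡0⇒All02 : ∀ ds → All (_< 3) ds → count1 ds ≡ 0 → All (λ d → d ≡ 0 ⊎ d ≡ 2) ds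
  count1≡0⇒All02 []       []         _  = []
  count1≡0⇒All02 (0 ∷ ds) (_ ∷ ds<3) eq = inj₁ refl ∷ count1≡0⇒All02 ds ds<3 eq
  count1≡0⇒All02 (2 ∷ ds) (_ ∷ ds<3) eq = inj₂ refl ∷ count1≡0⇒All02 ds ds<3 eq
  count1≡0⇒All02 (suc (suc (suc _)) ∷ _) (s<s (s<s (s<s ())) ∷ _) _

  0^n≡0 : ∀ {n} → n ≢ 0 → 0 ^ n ≡ 0
  0^n≡0 {zero}  n≢0 = contradiction refl n≢0
  0^n≡0 {suc n} _   = refl

  module Terms (r′ s′ : ℕ) where

    r s : ℕ
    r = suc r′
    s = suc s′

    open ≈₃-Reasoning

    term : ℕ → ℕ → ℕ
    term n k = (n C k) ^ r * ((n + k) C k) ^ s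

    term-zero : ∀ n → term n 0 ≡ 1
    term-zero n = cong₂ _*_ (^-zeroˡ r) (^-zeroˡ s)

    term-vanish : ∀ {n k} → n < k → term n k ≡ 0
    term-vanish {n} {k} n<k = cong (λ c → c ^ r * ((n + k) C k) ^ s) (k>n⇒nCk≡0 n<k)

    a-as-∑< : ∀ {n N} → n < N → a r s n ≡ ∑< N (term n)
    a-as-∑< {n} n<N = trans (sum-map-applyUpTo (suc n) (λ k → k) (term n))
                            (sym (∑<-extend (term n) n<N (λ _ → term-vanish)))

    term-noCarry : ∀ {d e m j} → d + e < 3 → term (d + m * 3) (e + j * 3) ≈₃ term d e * term m j
    term-noCarry {d} {e} {m} {j} d+e<3 = begin
      (n C k) ^ r * ((n + k) C k) ^ s
        ≡⟨ cong (λ N → (n C k) ^ r * (N C k) ^ s) (digitwise-+ d e m j) ⟩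
      (n C k) ^ r * ((d + e + (m + j) * 3) C k) ^ s
        ≈⟨ *-cong₃ (^-congˡ₃ r (lucas m d d<3 j e e<3)) (^-congˡ₃ s (lucas (m + j) (d + e) d+e<3 j e e<3)) ⟩
      ((m C j) * (d C e)) ^ r * (((m + j) C j) * ((d + e) C e)) ^ s
        ≡⟨ cong₂ _*_ (^-distribʳ-* (m C j) (d C e) r) (^-distribʳ-* ((m + j) C j) ((d + e) C e) s) ⟩
      (m C j) ^ r * (d C e) ^ r * (((m + j) C j) ^ s * ((d + e) C e) ^ s)
        ≡⟨ regroup ((m C j) ^ r) ((d C e) ^ r) (((m + j) C j) ^ s) (((d + e) C e) ^ s) ⟩
      term d e * term m j ∎
      where
      n k : ℕ
      n = d + m * 3
      k = e + j * 3
      d<3 : d < 3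
      d<3 = ≤-<-trans (m≤m+n d e) d+e<3
      e<3 : e < 3
      e<3 = ≤-<-trans (m≤n+m e d) d+e<3
      regroup : ∀ a b c d → a * b * (c * d) ≡ b * d * (a * c)
      regroup = solve-∀

    -- A carry in d + e makes the last base-3 digit of n + k smaller than that of k.
    binom-carry : ∀ {d e m j} → d < 3 → e < 3 → 3 ≤ d + e →
                  (d + m * 3 + (e + j * 3)) C (e + j * 3) ≈₃ 0
    binom-carry {d} {e} {m} {j} d<3 e<3 3≤d+e = begin
      (d + m * 3 + k) C k           ≡⟨ cong (_C k) n+k≡c+[m+j+1]*3 ⟩
      (c + suc (m + j) * 3) C k     ≈⟨ lucas (suc (m + j)) c (<-trans c<e e<3) j e e<3 ⟩
      (suc (m + j) C j) * (c C e)   ≡⟨ cong ((suc (m + j) C j) *_) (k>n⇒nCk≡0 c<e) ⟩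
      (suc (m + j) C j) * 0         ≡⟨ *-zeroʳ (suc (m + j) C j) ⟩
      0                             ∎
      where
      k c : ℕ
      k = e + j * 3
      c = d + e ∸ 3
      3+c≡d+e : 3 + c ≡ d + e
      3+c≡d+e = m+[n∸m]≡n 3≤d+e
      c<e : c < e
      c<e = +-cancelˡ-< 3 c e (subst (_< 3 + e) (sym 3+c≡d+e) (+-monoˡ-< e d<3))
      shift : ∀ c x → 3 + c + x ≡ c + (3 + x)
      shift = solve-∀
      n+k≡c+[m+j+1]*3 : d + m * 3 + k ≡ c + suc (m + j) * 3
      n+k≡c+[m+j+1]*3 = trans (digitwise-+ d e m j)
        (trans (cong (_+ (m + j) * 3) (sym 3+c≡d+e)) (shift c ((m + j) * 3)))

    term-carry : ∀ {d e m j} → d < 3 → e < 3 → 3 ≤ d + e → term (d + m * 3) (e + j * 3) ≈₃ 0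
    term-carry {d} {e} {m} {j} d<3 e<3 3≤d+e =
      *-zeroʳ₃ (((d + m * 3) C (e + j * 3)) ^ r)
               (≈₃0⇒^suc≈₃0 s′ (binom-carry {m = m} {j = j} d<3 e<3 3≤d+e))

    term-carry-digit : ∀ {d e} → d < 3 → e < 3 → 3 ≤ d + e → term d e ≈₃ 0
    term-carry-digit {d} {e} d<3 e<3 3≤d+e =
      subst₂ (λ n k → term n k ≈₃ 0) (+-identityʳ d) (+-identityʳ e)
             (term-carry {m = 0} {j = 0} d<3 e<3 3≤d+e)

    term-mult : ∀ {d e m j} → d < 3 → e < 3 → term (d + m * 3) (e + j * 3) ≈₃ term d e * term m j
    term-mult {d} {e} {m} {j} d<3 e<3 with d + e <? 3
    ... | yes d+e<3 = term-noCarry {d} {e} {m} {j} d+e<3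
    ... | no  d+e≮3 = ≈₃-trans (term-carry {m = m} {j = j} d<3 e<3 (≮⇒≥ d+e≮3))
                               (≈₃-sym (*-zeroˡ₃ (term m j) (term-carry-digit d<3 e<3 (≮⇒≥ d+e≮3))))

    a-mult : ∀ {d m} → d < 3 → a r s (d + m * 3) ≈₃ a r s d * a r s m
    a-mult {d} {m} d<3 = begin
      a r s n                                               ≡⟨ a-as-∑< (+-monoˡ-< (m * 3) d<3) ⟩
      ∑< (suc m * 3) (term n)                               ≡⟨ ∑<-blocks (suc m) (term n) ⟩
      ∑< (suc m) (λ j → ∑< 3 (λ e → term n (e + j * 3)))    ≈⟨ ∑<-cong₃ (suc m) (λ j _ → block j) ⟩
      ∑< (suc m) (λ j → ∑< 3 (term d) * term m j)           ≡⟨ ∑<-*-distribˡ (suc m) (∑< 3 (term d)) (term m) ⟩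
      ∑< 3 (term d) * ∑< (suc m) (term m)                   ≡⟨ cong₂ _*_ (a-as-∑< {n = d} d<3) (a-as-∑< {n = m} ≤-refl) ⟨
      a r s d * a r s m                                     ∎
      where
      n : ℕ
      n = d + m * 3
      block : ∀ j → ∑< 3 (λ e → term n (e + j * 3)) ≈₃ ∑< 3 (term d) * term m j
      block j = ≈₃-trans (∑<-cong₃ 3 (λ e e<3 → term-mult {m = m} {j = j} d<3 e<3))
                         (≡⇒≈₃ (∑<-*-distribʳ 3 (term d) (term m j)))

    a-zero : a r s 0 ≡ 1
    a-zero = trans (+-identityʳ (term 0 0)) (term-zero 0)

    a-one : a r s 1 ≡ 1 + 2 ^ s
    a-one = cong₂ _+_ (term-zero 1)
      (trans (+-identityʳ (1 ^ r * 2 ^ s)) (trans (cong (_* 2 ^ s) (^-zeroˡ r)) (*-identityˡ (2 ^ s))))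

    a-two : a r s 2 ≈₃ 1
    a-two = +-cong₃ (≡⇒≈₃ (term-zero 2))
              (+-cong₃ (term-carry-digit (n<1+n 2) (s<s z<s) ≤-refl)
                (+-cong₃ (term-carry-digit (n<1+n 2) (n<1+n 2) (n≤1+n 3)) ≈₃-refl))

    a₁≈1+2^[s%2] : ∀ {p} → s % 2 ≡ p → a r s 1 ≈₃ 1 + 2 ^ p
    a₁≈1+2^[s%2] refl = ≈₃-trans (≡⇒≈₃ a-one) (+-cong₃ ≈₃-refl (2^n≈₃2^[n%2] s))

    a-digits : ∀ f n → n ≤ f → a r s n ≈₃ product (map (a r s) (digits3-fuel f n))
    a-digits zero    zero    _   = ≡⇒≈₃ a-zero
    a-digits (suc f) zero    _   = ≡⇒≈₃ a-zero
    a-digits (suc f) (suc n) n<f = begin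
      a r s (suc n)                              ≡⟨ cong (a r s) (m≡m%n+[m/n]*n (suc n) 3) ⟩
      a r s (suc n % 3 + (suc n / 3) * 3)        ≈⟨ a-mult {m = suc n / 3} (m%n<n (suc n) 3) ⟩
      a r s (suc n % 3) * a r s (suc n / 3)      ≈⟨ *-cong₃ (≈₃-refl {a r s (suc n % 3)}) (a-digits f (suc n / 3) q≤f) ⟩
      product (map (a r s) (digits3-fuel (suc f) (suc n))) ∎
      where
      q≤f : suc n / 3 ≤ f
      q≤f = ≤-pred (<-≤-trans (m/n<m (suc n) 3 (s<s z<s)) n<f)

    a≈[a₁]^δ₃ : ∀ {x} n → a r s 1 ≈₃ x → a r s n ≈₃ x ^ δ₃ n
    a≈[a₁]^δ₃ n a₁≈x = ≈₃-trans (a-digits n n ≤-refl)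
      (product-map-count1 (≡⇒≈₃ a-zero) a₁≈x a-two (digits3 n) (digits3-fuel-<3 n n))

    a₁≈2 : s % 2 ≡ 0 → a r s 1 ≈₃ 2
    a₁≈2 = a₁≈1+2^[s%2]

    a≈0^δ₃ : ∀ n → s % 2 ≡ 1 → a r s n ≈₃ 0 ^ δ₃ n
    a≈0^δ₃ n s-odd = a≈[a₁]^δ₃ n (≈₃-trans (a₁≈1+2^[s%2] s-odd) (mk≈₃ refl))

    a≈1-T02 : ∀ n → s % 2 ≡ 1 → T02 n → a r s n ≈₃ 1
    a≈1-T02 n s-odd t = subst (λ c → a r s n ≈₃ 0 ^ c) (All02⇒count1≡0 t) (a≈0^δ₃ n s-odd)

    a≈0-¬T02 : ∀ n → s % 2 ≡ 1 → ¬ T02 n → a r s n ≈₃ 0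
    a≈0-¬T02 n s-odd ¬t = subst (a r s n ≈₃_) (0^n≡0 δ₃≢0) (a≈0^δ₃ n s-odd)
      where
      δ₃≢0 : δ₃ n ≢ 0
      δ₃≢0 = ¬t ∘ count1≡0⇒All02 (digits3 n) (digits3-fuel-<3 n n)

module IntegerCongruence where

  open import Data.Nat using (ℕ; zero; suc; _*_; _^_; _%_; _/_)
  open import Data.Nat.DivMod using (m≡m%n+[m/n]*n)
  open import Data.Integer as ℤ using (+_)
  import Data.Integer.Properties as ℤ
  import Data.Integer.Tactic.RingSolver as ℤ-Solver
  open import Data.Integer.Divisibility.Signed
    using (_∣_; divides; ∣ᵤ⇒∣; ∣⇒∣ᵤ; ∣-refl; ∣m∣n⇒∣m+n; ∣n⇒∣m*n)
  open import Relation.Binary.PropositionalEquality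
  open import Function using (_∘_)
  open Mod3 using (_≈₃_; mk≈₃)

  +-divMod₃ : ∀ n → + n ≡ + (n % 3) ℤ.+ + (n / 3) ℤ.* + 3
  +-divMod₃ n = trans (cong +_ (m≡m%n+[m/n]*n n 3))
                      (trans (ℤ.pos-+ (n % 3) _) (cong (λ t → + (n % 3) ℤ.+ t) (ℤ.pos-* (n / 3) 3)))

  ≈₃⇒3∣- : ∀ {x y} → x ≈₃ y → + 3 ∣ + x ℤ.- + y
  ≈₃⇒3∣- {x} {y} (mk≈₃ x%3≡y%3) = divides (+ (x / 3) ℤ.- + (y / 3)) (begin
    + x ℤ.- + y
      ≡⟨ cong₂ ℤ._-_ (+-divMod₃ x) (+-divMod₃ y) ⟩
    (+ (x % 3) ℤ.+ + (x / 3) ℤ.* + 3) ℤ.- (+ (y % 3) ℤ.+ + (y / 3) ℤ.* + 3)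
      ≡⟨ cong (λ t → (+ t ℤ.+ + (x / 3) ℤ.* + 3) ℤ.- (+ (y % 3) ℤ.+ + (y / 3) ℤ.* + 3)) x%3≡y%3 ⟩
    (+ (y % 3) ℤ.+ + (x / 3) ℤ.* + 3) ℤ.- (+ (y % 3) ℤ.+ + (y / 3) ℤ.* + 3)
      ≡⟨ cancel (+ (y % 3)) (+ (x / 3)) (+ (y / 3)) ⟩
    (+ (x / 3) ℤ.- + (y / 3)) ℤ.* + 3 ∎)
    where
    open ≡-Reasoning
    cancel : ∀ a p q → (a ℤ.+ p ℤ.* + 3) ℤ.- (a ℤ.+ q ℤ.* + 3) ≡ (p ℤ.- q) ℤ.* + 3
    cancel = ℤ-Solver.solve-∀

  ≈₃⇒≡[mod3] : ∀ {x y} → x ≈₃ y → + x ≡ + y [mod 3 ]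
  ≈₃⇒≡[mod3] = ∣⇒∣ᵤ ∘ ≈₃⇒3∣-

  3∣2^n-[-1]^n : ∀ n → + 3 ∣ + (2 ^ n) ℤ.- -1ℤ ℤ.^ n
  3∣2^n-[-1]^n zero    = divides (+ 0) refl
  3∣2^n-[-1]^n (suc n) =
    subst (+ 3 ∣_) (sym (trans (cong (ℤ._- -1ℤ ℤ.^ suc n) (ℤ.pos-* 2 (2 ^ n)))
                               (step (+ (2 ^ n)) (-1ℤ ℤ.^ n))))
      (∣m∣n⇒∣m+n (∣n⇒∣m*n (+ 2) (3∣2^n-[-1]^n n)) (∣n⇒∣m*n (-1ℤ ℤ.^ n) ∣-refl))
    where
    step : ∀ x v → + 2 ℤ.* x ℤ.- -1ℤ ℤ.* v ≡ + 2 ℤ.* (x ℤ.- v) ℤ.+ v ℤ.* + 3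
    step = ℤ-Solver.solve-∀

  ≈₃2^⇒≡[-1]^[mod3] : ∀ {x} n → x ≈₃ 2 ^ n → + x ≡ -1ℤ ℤ.^ n [mod 3 ]
  ≈₃2^⇒≡[-1]^[mod3] {x} n x≈2^n = ∣⇒∣ᵤ (subst (+ 3 ∣_)
    (telescope (+ x) (+ (2 ^ n)) (-1ℤ ℤ.^ n))
    (∣m∣n⇒∣m+n (≈₃⇒3∣- x≈2^n) (3∣2^n-[-1]^n n)))
    where
    telescope : ∀ x y z → (x ℤ.- y) ℤ.+ (y ℤ.- z) ≡ x ℤ.- z
    telescope = ℤ-Solver.solve-∀

open Mod3
open IntegerCongruence
open import Data.Nat using (ℕ; zero; suc; _%_; _≥_)
open import Data.Integer using (+_; _^_)
open import Relation.Binary.PropositionalEquality using (_≡_)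
open import Relation.Nullary using (¬_)
open import Data.Product using (_×_; _,_)
open import Function using (_∘_)

theorem5p7 : (r s : ℕ) → r ≥ 1 → s ≥ 1 → (n : ℕ) →
    (s % 2 ≡ 0 → + a r s n ≡ -1ℤ ^ δ₃ n [mod 3 ])
    × (s % 2 ≡ 1 → T02 n → + a r s n ≡ + 1 [mod 3 ])
    × (s % 2 ≡ 1 → ¬ T02 n → + a r s n ≡ + 0 [mod 3 ])
theorem5p7 zero     _        ()  _ _
theorem5p7 (suc _)  zero     _   () _
theorem5p7 (suc r′) (suc s′) _   _  n =
    (λ s-even → ≈₃2^⇒≡[-1]^[mod3] (δ₃ n) (a≈[a₁]^δ₃ n (a₁≈2 s-even)))
  , (λ s-odd → ≈₃⇒≡[mod3] ∘ a≈1-T02 n s-odd)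
  , (λ s-odd → ≈₃⇒≡[mod3] ∘ a≈0-¬T02 n s-odd)
  where open Terms r′ s′
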